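{- Let $t$ be a $\beta$-normal $\lambda$-term, $v$ a $\lambda$-term, and $\alpha,x,x_1,\dots,x_n$ variables ($n\ge 0$) with $\alpha\notin\{x_1,\dots,x_n\}$ and $x\in Fv(t)$. If $t[\lambda x_1\dots\lambda x_n\alpha/x]\rightarrow_\beta v$, then $\alpha\in Fv(v)$.
   Context: $\lambda$-terms are pure $\lambda$-terms; $Fv(t)$ is the set of free variables of $t$; $t[u/x]$ is capture-avoiding substitution; $\rightarrow_\beta$ denotes $\beta$-reduction in zero or more steps. -}

module Defs where

open import Data.Nat using (ℕ; zero; suc; _+_; _≟_)
open import Relation.Nullary using (¬_; yes; no)
open import Relation.Binary.Construct.Closure.ReflexiveTransitive using (Star)

-- Pure untyped λ-terms, de Bruijn indices (free variables = indices
-- escaping all enclosing binders; a free variable is named by its index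
-- relative to the outside of the term).
data Term : Set where
  var : ℕ → Term
  app : Term → Term → Term
  lam : Term → Term

ext : (ℕ → ℕ) → ℕ → ℕ
ext ρ zero    = zero
ext ρ (suc i) = suc (ρ i)

rename : (ℕ → ℕ) → Term → Term
rename ρ (var i)   = var (ρ i)
rename ρ (app t u) = app (rename ρ t) (rename ρ u)
rename ρ (lam t)   = lam (rename (ext ρ) t)

exts : (ℕ → Term) → ℕ → Term
exts σ zero    = var zero
exts σ (suc i) = rename suc (σ i)

subst : (ℕ → Term) → Term → Term
subst σ (var i)   = σ i
subst σ (app t u) = app (subst σ t) (subst σ u)
subst σ (lam t)   = lam (subst (exts σ) t)

_[_/_] : Term → Term → ℕ → Term
t [ u / x ] = subst σ t
  where
  σ : ℕ → Term
  σ i with i ≟ x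
  ... | yes _ = u
  ... | no  _ = var i

_[_]₀ : Term → Term → Term
b [ a ]₀ = subst σ b
  where
  σ : ℕ → Term
  σ zero    = a
  σ (suc i) = var i

infix 4 _⟶β_
data _⟶β_ : Term → Term → Set where
  β    : ∀ {b a} → app (lam b) a ⟶β b [ a ]₀
  appL : ∀ {t t' u} → t ⟶β t' → app t u ⟶β app t' u
  appR : ∀ {t u u'} → u ⟶β u' → app t u ⟶β app t u'
  ξ    : ∀ {t t'} → t ⟶β t' → lam t ⟶β lam t'

infix 4 _⟶β*_
_⟶β*_ : Term → Term → Set
_⟶β*_ = Star _⟶β_

BetaNormal : Term → Set
BetaNormal t = ∀ t' → ¬ (t ⟶β t')

data _∈Fv_ : ℕ → Term → Set where
  var  : ∀ {i} → i ∈Fv var i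
  appl : ∀ {i t u} → i ∈Fv t → i ∈Fv app t u
  appr : ∀ {i t u} → i ∈Fv u → i ∈Fv app t u
  lam  : ∀ {i t} → suc i ∈Fv t → i ∈Fv lam t

-- λx₁…λxₙ.α with α distinct from the xᵢ : n binders over the free variable α.
lams : ℕ → Term → Term
lams zero    t = t
lams (suc n) t = lam (lams n t)

projTerm : ℕ → ℕ → Term
projTerm n α = lams n (var (n + α))

-- If t is β-normal and x ∈ Fv(t), then in t[λx₁…λxₙ.α / x] the variable α
-- sits in a position that no β-reduction can erase.
--
-- Such positions are captured by the predicate  Stable a  (below): a term is
-- stable for a if, beneath some λ's, it is either
--   * a projection λy₁…λyₘ.a applied to arguments (the head stays a
--     projection onto a whatever reductions happen), or
--   * a neutral spine  h u₁ … uₖ  (head h a variable) one of whose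
--     components is again stable for a.
module Submission where

open import Defs
open import Data.Nat using (ℕ; zero; suc; _≟_)
open import Data.Nat.Properties using (+-suc)
open import Data.Empty using (⊥-elim)
open import Data.Product using (∃; _,_)
open import Data.Sum using (_⊎_; inj₁; inj₂)
open import Relation.Nullary using (¬_; yes; no)
open import Relation.Binary.PropositionalEquality
  using (_≡_; refl; cong) renaming (subst to transport)
open import Relation.Binary.Construct.Closure.ReflexiveTransitive using (ε; _◅_)

data Proj : ℕ → Term → Set where
  here  : ∀ {k} → Proj k (var k)
  under : ∀ {k t} → Proj (suc k) t → Proj k (lam t)

data ProjApp (k : ℕ) : Term → Set where
  proj : ∀ {t} → Proj k t → ProjApp k t
  app  : ∀ {t u} → ProjApp k t → ProjApp k (app t u)

data Neutral : Term → Set where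
  var : ∀ {h} → Neutral (var h)
  app : ∀ {t u} → Neutral t → Neutral (app t u)

data Stable (a : ℕ) : Term → Set where
  lam  : ∀ {t} → Stable (suc a) t → Stable a (lam t)
  head : ∀ {t} → ProjApp a t → Stable a t
  fun  : ∀ {t u} → Neutral t → Stable a t → Stable a (app t u)
  arg  : ∀ {t u} → Neutral t → Stable a u → Stable a (app t u)

projTerm-proj : ∀ n α → Proj α (projTerm n α)
projTerm-proj zero    α = here
projTerm-proj (suc n) α =
  under (transport (λ j → Proj (suc α) (lams n (var j))) (+-suc n α)
                   (projTerm-proj n (suc α)))

proj-rename : ∀ {k t} (ρ : ℕ → ℕ) → Proj k t → Proj (ρ k) (rename ρ t)
proj-rename ρ here      = here
proj-rename ρ (under p) = under (proj-rename (ext ρ) p)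

proj-subst : ∀ {k j t} (σ : ℕ → Term) → σ k ≡ var j → Proj k t → Proj j (subst σ t)
proj-subst σ σk≡j here rewrite σk≡j = here
proj-subst σ σk≡j (under p) = under (proj-subst (exts σ) (cong (rename suc) σk≡j) p)

proj-normal : ∀ {k t} → Proj k t → BetaNormal t
proj-normal here      _ ()
proj-normal (under p) _ (ξ s) = proj-normal p _ s

neutral-step : ∀ {t t'} → Neutral t → t ⟶β t' → Neutral t'
neutral-step (app n) (appL s) = app (neutral-step n s)
neutral-step (app n) (appR s) = app n

-- Contracting the head redex of a projection onto k applied to arguments
-- instantiates the outermost binder, which is not the projected variable.
projApp-step : ∀ {k t t'} → ProjApp k t → t ⟶β t' → ProjApp k t'
projApp-step (proj p)                 s        = ⊥-elim (proj-normal p _ s)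
projApp-step (app (proj (under p)))   β        = proj (proj-subst _ refl p)
projApp-step (app h)                  (appL s) = app (projApp-step h s)
projApp-step (app h)                  (appR s) = app h

-- A neutral function position can never be contracted as a redex.
stable-step : ∀ {a t t'} → Stable a t → t ⟶β t' → Stable a t'
stable-step (lam r)   (ξ s)    = lam (stable-step r s)
stable-step (head h)  s        = head (projApp-step h s)
stable-step (fun n r) (appL s) = fun (neutral-step n s) (stable-step r s)
stable-step (fun n r) (appR s) = fun n r
stable-step (arg n r) (appL s) = arg (neutral-step n s) r
stable-step (arg n r) (appR s) = arg n (stable-step r s)

stable-steps : ∀ {a t t'} → Stable a t → t ⟶β* t' → Stable a t'
stable-steps r ε        = r
stable-steps r (s ◅ ss) = stable-steps (stable-step r s) ss

proj-fv : ∀ {k t} → Proj k t → k ∈Fv t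
proj-fv here      = var
proj-fv (under p) = lam (proj-fv p)

projApp-fv : ∀ {k t} → ProjApp k t → k ∈Fv t
projApp-fv (proj p) = proj-fv p
projApp-fv (app h)  = appl (projApp-fv h)

stable-fv : ∀ {a t} → Stable a t → a ∈Fv t
stable-fv (lam r)   = lam (stable-fv r)
stable-fv (head h)  = projApp-fv h
stable-fv (fun _ r) = appl (stable-fv r)
stable-fv (arg _ r) = appr (stable-fv r)

record ProjSubst (σ : ℕ → Term) (x a : ℕ) : Set where
  field
    at-x     : Proj a (σ x)
    off-x    : ∀ i → ¬ i ≡ x → ∃ λ j → σ i ≡ var j
open ProjSubst

projSubst-exts : ∀ {σ x a} → ProjSubst σ x a → ProjSubst (exts σ) (suc x) (suc a)
projSubst-exts {σ} {x} P = record { at-x = proj-rename suc (at-x P) ; off-x = off }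
  where
  off : ∀ i → ¬ i ≡ suc x → ∃ λ j → exts σ i ≡ var j
  off zero    _    = zero , refl
  off (suc i) i≢sx with off-x P i (λ i≡x → i≢sx (cong suc i≡x))
  ... | j , σi≡j = suc j , cong (rename suc) σi≡j

normal-shape : ∀ t → BetaNormal t → (∃ λ b → t ≡ lam b) ⊎ Neutral t
normal-shape (var i)   _  = inj₂ var
normal-shape (lam b)   _  = inj₁ (b , refl)
normal-shape (app t u) nf with normal-shape t (λ t' s → nf _ (appL s))
... | inj₁ (b , refl) = ⊥-elim (nf _ β)
... | inj₂ n          = inj₂ (app n)

neutral-fun : ∀ {t u} → Neutral (app t u) → Neutral t
neutral-fun (app n) = n

neutral-subst : ∀ {σ x a t} → ProjSubst σ x a → Neutral t →
                ProjApp a (subst σ t) ⊎ Neutral (subst σ t)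
neutral-subst {x = x} P (var {h}) with h ≟ x
... | yes refl = inj₁ (proj (at-x P))
... | no h≢x with off-x P h h≢x
...   | j , σh≡j rewrite σh≡j = inj₂ var
neutral-subst P (app n) with neutral-subst P n
... | inj₁ h = inj₁ (app h)
... | inj₂ m = inj₂ (app m)

stable-subst : ∀ {σ x a} t → ProjSubst σ x a → BetaNormal t → x ∈Fv t →
               Stable a (subst σ t)
stable-subst (lam t) P nf (lam x∈t) =
  lam (stable-subst t (projSubst-exts P) (λ t' s → nf _ (ξ s)) x∈t)
stable-subst (var _) P nf var = head (proj (at-x P))
stable-subst (app t u) P nf x∈tu with normal-shape (app t u) nf
... | inj₁ (_ , ())
... | inj₂ ntu with neutral-subst P ntu
...   | inj₁ h  = head h
...   | inj₂ m with x∈tu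
...     | appl x∈t = fun (neutral-fun m) (stable-subst t P (λ t' s → nf _ (appL s)) x∈t)
...     | appr x∈u = arg (neutral-fun m) (stable-subst u P (λ u' s → nf _ (appR s)) x∈u)

-- Part 3: the single substitution [u / x], as a function on variables;
-- t [ u / x ] is  subst (single u x) t  by η.
single : Term → ℕ → ℕ → Term
single u x i = var i [ u / x ]

single-projSubst : ∀ n α x → ProjSubst (single (projTerm n α) x) x α
single-projSubst n α x = record { at-x = at ; off-x = off }
  where
  at : Proj α (single (projTerm n α) x x)
  at with x ≟ x
  ... | yes _  = projTerm-proj n α
  ... | no x≢x = ⊥-elim (x≢x refl)

  off : ∀ i → ¬ i ≡ x → ∃ λ j → single (projTerm n α) x i ≡ var j
  off i i≢x with i ≟ x
  ... | yes i≡x = ⊥-elim (i≢x i≡x)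
  ... | no _    = i , refl

lemma2p1p2 : (t v : Term) (n α x : ℕ) → BetaNormal t → x ∈Fv t →
    (t [ projTerm n α / x ]) ⟶β* v → α ∈Fv v
lemma2p1p2 t v n α x nf x∈t red =
  stable-fv (stable-steps (stable-subst t (single-projSubst n α x) nf x∈t) red)
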